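{- Let $\ell$ be a prime, $q$ a prime power with $\ell\nmid q$, $\gamma\ge1$, $d\in(\mathbb{Z}/\ell^\gamma\mathbb{Z})^\times$ with $d^2q\equiv1\pmod{\ell^\gamma}$, and $t\in\mathbb{Z}$ with $t\equiv dq+d^{ -1}\pmod{\ell^{2\gamma}}$. Then for every $i\ge2\gamma$, every $c$ with $c^2-tc+q\equiv0\pmod{\ell^i}$ satisfies $c\equiv d^{ -1}\pmod{\ell^\gamma}$.
   Context: $dq+d^{ -1}\pmod{\ell^{2\gamma}}$ denotes $\tilde dq+\tilde d^{ -1}$ for any lift $\tilde d$ of $d$ to $\mathbb{Z}/\ell^{2\gamma}\mathbb{Z}$; it is independent of the lift because $d^2q\equiv1\pmod{\ell^\gamma}$. -}

module Defs where

open import Data.Nat using (ℕ; _≥_; _^_)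
open import Data.Nat.Primality using (Prime)
open import Data.Integer using (ℤ; +_; _-_)
open import Data.Integer.Divisibility using (_∣_)
open import Data.Product using (∃₂; _×_)
open import Relation.Binary.PropositionalEquality using (_≡_)

_≡_[mod_] : ℤ → ℤ → ℕ → Set
a ≡ b [mod m ] = (+ m) ∣ (a - b)

infix 4 _≡_[mod_]

IsPrimePower : ℕ → Set
IsPrimePower q = ∃₂ λ p k → Prime p × k ≥ 1 × q ≡ p ^ k

module Submission where

-- Put  x = c - e  and  z = dq - e.  Modulo ℓ^(2γ) the hypotheses
-- give  t ≡ dq + e  and  q ≡ dq·e, so the characteristic polynomial factors:
--     c² - tc + q  ≡  (c - dq)(c - e)  =  x (x - z)        (mod ℓ^(2γ)).
-- Moreover  dq - e = e(d²q - 1) - dq(de - 1)  is divisible by ℓ^γ, i.e. z is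
-- divisible by ℓ^γ.  The theorem then follows from a general ℓ-adic fact
-- about "near-square" products (Lemma  ℓ^n∣x):
--     ℓ prime,  ℓ^n ∣ z,  ℓ^(2n) ∣ x (x - z)   ⟹   ℓ^n ∣ x,
-- proved by induction on n: ℓ divides x by Euclid's lemma, and dividing x and
-- z by ℓ lowers both exponents.

open import Defs
open import Data.Nat using (ℕ; _≥_; _^_; zero; suc; _≤_; _∸_)
  renaming (_*_ to _ℕ*_; _+_ to _ℕ+_)
open import Data.Nat.Primality using (Prime; euclidsLemma; prime⇒nonZero)
open import Data.Integer using (ℤ; +_; _-_; _+_; _*_; ∣_∣; NonZero)
open import Relation.Nullary using (¬_)
import Data.Nat.Divisibility as ℕD
import Data.Nat.Properties as ℕP
import Data.Integer.Properties as ℤP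
open import Data.Integer.Divisibility.Signed
  using (_∣_; divides; ∣ᵤ⇒∣; ∣⇒∣ᵤ; ∣-trans; ∣m∣n⇒∣m+n; ∣m⇒∣-m;
         ∣m∣n⇒∣m-n; ∣m+n∣n⇒∣m; ∣n⇒∣m*n; ∣m⇒∣m*n; *-monoˡ-∣; *-cancelʳ-∣)
open import Data.Sum using (inj₁; inj₂)
open import Relation.Binary.PropositionalEquality
open import Data.Integer.Tactic.RingSolver using (solve-∀)

^-mono-∣ : ∀ ℓ {a b} → a ≤ b → + (ℓ ^ a) ∣ + (ℓ ^ b)
^-mono-∣ ℓ {a} {b} a≤b = ∣ᵤ⇒∣ (ℕD.divides (ℓ ^ (b ∸ a)) (begin
    ℓ ^ b                   ≡⟨ cong (ℓ ^_) (sym (ℕP.m+[n∸m]≡n a≤b)) ⟩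
    ℓ ^ (a ℕ+ (b ∸ a))      ≡⟨ ℕP.^-distribˡ-+-* ℓ a (b ∸ a) ⟩
    ℓ ^ a ℕ* ℓ ^ (b ∸ a)    ≡⟨ ℕP.*-comm (ℓ ^ a) _ ⟩
    ℓ ^ (b ∸ a) ℕ* ℓ ^ a    ∎))
  where open ≡-Reasoning

^-suc : ∀ ℓ n → + (ℓ ^ suc n) ≡ + (ℓ ^ n) * + ℓ
^-suc ℓ n = trans (ℤP.pos-* ℓ (ℓ ^ n)) (ℤP.*-comm (+ ℓ) _)

ℓ∣ℓ^suc : ∀ ℓ n → + ℓ ∣ + (ℓ ^ suc n)
ℓ∣ℓ^suc ℓ n = divides (+ (ℓ ^ n)) (^-suc ℓ n)

^-2suc : ∀ ℓ n → + (ℓ ^ (2 ℕ* suc n)) ≡ + (ℓ ^ (2 ℕ* n)) * + ℓ * + ℓ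
^-2suc ℓ n = begin
    + (ℓ ^ (2 ℕ* suc n))                 ≡⟨ cong (λ k → + (ℓ ^ suc k)) (ℕP.+-suc n (n ℕ+ 0)) ⟩
    + (ℓ ^ suc (suc (2 ℕ* n)))           ≡⟨ ^-suc ℓ (suc (2 ℕ* n)) ⟩
    + (ℓ ^ suc (2 ℕ* n)) * + ℓ           ≡⟨ cong (_* + ℓ) (^-suc ℓ (2 ℕ* n)) ⟩
    + (ℓ ^ (2 ℕ* n)) * + ℓ * + ℓ         ∎
  where open ≡-Reasoning

ℓ∣x : ∀ {ℓ} → Prime ℓ → ∀ x z → + ℓ ∣ z → + ℓ ∣ x * (x - z) → + ℓ ∣ x
ℓ∣x {ℓ} pℓ x z ℓ∣z ℓ∣x[x-z]
  with euclidsLemma ∣ x ∣ ∣ x - z ∣ pℓ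
         (subst (ℓ ℕD.∣_) (ℤP.abs-* x (x - z)) (∣⇒∣ᵤ ℓ∣x[x-z]))
... | inj₁ ℓ∣∣x∣     = ∣ᵤ⇒∣ ℓ∣∣x∣
... | inj₂ ℓ∣∣x-z∣   = ∣m+n∣n⇒∣m (∣ᵤ⇒∣ ℓ∣∣x-z∣) (∣m⇒∣-m ℓ∣z)

ℓ^n∣x : ∀ {ℓ} → Prime ℓ → ∀ n x z →
        + (ℓ ^ n) ∣ z → + (ℓ ^ (2 ℕ* n)) ∣ x * (x - z) → + (ℓ ^ n) ∣ x
ℓ^n∣x pℓ zero    x z _ _ = divides x (sym (ℤP.*-identityʳ x))
ℓ^n∣x {ℓ} pℓ (suc n) x z ℓⁿ⁺¹∣z ℓ²ⁿ⁺²∣x[x-z]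
  -- ℓ divides z and x (x - z), hence x; write x = X ℓ and z = Z ℓ.
  -- (2(n+1) unfolds to suc (n + suc (n + 0)).)
  with ℓ∣x pℓ x z (∣-trans (ℓ∣ℓ^suc ℓ n) ℓⁿ⁺¹∣z)
                  (∣-trans (ℓ∣ℓ^suc ℓ (n ℕ+ suc (n ℕ+ 0))) ℓ²ⁿ⁺²∣x[x-z])
     | ∣-trans (ℓ∣ℓ^suc ℓ n) ℓⁿ⁺¹∣z
... | divides X refl | divides Z refl =
  subst (_∣ X * + ℓ) (sym (^-suc ℓ n)) (*-monoˡ-∣ (+ ℓ) ℓⁿ∣X)
  where
  instance
    ℓ≢0 : NonZero (+ ℓ)
    ℓ≢0 = prime⇒nonZero pℓ

  ℓⁿ∣Z : + (ℓ ^ n) ∣ Z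
  ℓⁿ∣Z = *-cancelʳ-∣ (+ ℓ) (subst (_∣ Z * + ℓ) (^-suc ℓ n) ℓⁿ⁺¹∣z)

  ℓ²ⁿ∣X[X-Z] : + (ℓ ^ (2 ℕ* n)) ∣ X * (X - Z)
  ℓ²ⁿ∣X[X-Z] = *-cancelʳ-∣ (+ ℓ) (*-cancelʳ-∣ (+ ℓ)
    (subst₂ _∣_ (^-2suc ℓ n) (scale X Z (+ ℓ)) ℓ²ⁿ⁺²∣x[x-z]))
    where
    scale : ∀ X Z L → X * L * (X * L - Z * L) ≡ X * (X - Z) * L * L
    scale = solve-∀

  ℓⁿ∣X : + (ℓ ^ n) ∣ X
  ℓⁿ∣X = ℓ^n∣x pℓ n X Z ℓⁿ∣Z ℓ²ⁿ∣X[X-Z]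

dq≡e : ∀ m d e q → + m ∣ d * e - + 1 → + m ∣ d * d * q - + 1 → + m ∣ d * q - e
dq≡e m d e q m∣de-1 m∣d²q-1 =
  subst (+ m ∣_) (sym (split d e q))
    (∣m∣n⇒∣m-n (∣n⇒∣m*n e m∣d²q-1) (∣n⇒∣m*n (d * q) m∣de-1))
  where
  split : ∀ d e q → d * q - e ≡ e * (d * d * q - + 1) - d * q * (d * e - + 1)
  split = solve-∀

factorisation : ∀ m c d e q t → + m ∣ d * e - + 1 → + m ∣ t - (d * q + e) →
                + m ∣ c * c - t * c + q - + 0 →
                + m ∣ (c - e) * ((c - e) - (d * q - e))
factorisation m c d e q t m∣de-1 m∣t-[dq+e] m∣poly =
  subst (+ m ∣_) (sym (expand c d e q t))
    (∣m∣n⇒∣m+n (∣m∣n⇒∣m+n m∣poly (∣m⇒∣m*n c m∣t-[dq+e])) (∣n⇒∣m*n q m∣de-1))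
  where
  expand : ∀ c d e q t → (c - e) * ((c - e) - (d * q - e)) ≡
           (c * c - t * c + q - + 0) + (t - (d * q + e)) * c + q * (d * e - + 1)
  expand = solve-∀

lemma8 : (ℓ q γ : ℕ) → Prime ℓ → IsPrimePower q → ¬ (ℓ ℕD.∣ q) → γ ≥ 1 →
         (d e t : ℤ) →
         d * e ≡ + 1 [mod ℓ ^ (2 ℕ* γ) ] →
         d * d * + q ≡ + 1 [mod ℓ ^ γ ] →
         t ≡ d * + q + e [mod ℓ ^ (2 ℕ* γ) ] →
         (i : ℕ) → i ≥ 2 ℕ* γ → (c : ℤ) →
         c * c - t * c + + q ≡ + 0 [mod ℓ ^ i ] →
         c ≡ e [mod ℓ ^ γ ]
lemma8 ℓ q γ pℓ _ _ _ d e t de≡1 d²q≡1 t≡dq+e i i≥2γ c root =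
  ∣⇒∣ᵤ (ℓ^n∣x pℓ γ (c - e) (d * + q - e) ℓ^γ∣dq-e ℓ^2γ∣[c-e][c-dq])
  where
  ℓ^γ∣ℓ^2γ : + (ℓ ^ γ) ∣ + (ℓ ^ (2 ℕ* γ))
  ℓ^γ∣ℓ^2γ = ^-mono-∣ ℓ (ℕP.m≤m+n γ (γ ℕ+ 0))

  ℓ^γ∣dq-e : + (ℓ ^ γ) ∣ d * + q - e
  ℓ^γ∣dq-e = dq≡e (ℓ ^ γ) d e (+ q) (∣-trans ℓ^γ∣ℓ^2γ (∣ᵤ⇒∣ de≡1)) (∣ᵤ⇒∣ d²q≡1)

  ℓ^2γ∣[c-e][c-dq] : + (ℓ ^ (2 ℕ* γ)) ∣ (c - e) * ((c - e) - (d * + q - e))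
  ℓ^2γ∣[c-e][c-dq] = factorisation (ℓ ^ (2 ℕ* γ)) c d e (+ q) t (∣ᵤ⇒∣ de≡1) (∣ᵤ⇒∣ t≡dq+e)
    (∣-trans (^-mono-∣ ℓ i≥2γ) (∣ᵤ⇒∣ root))
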